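{- If $\Gamma \models \mathbb{M}:\tau$ and $\mathbb{M} \longrightarrow \mathbb{M}'$ then $\Gamma \models \mathbb{M}' :\tau$.
   Context: $\widehat{\lambda}^{\text{↯}}_{\oplus}$: resource calculus with sharing and failure, terms $M ::= x \mid \lambda x.(M[\widetilde{x}\leftarrow x]) \mid M\,B \mid M\langle\!\langle N/x\rangle\!\rangle \mid \mathtt{fail}^{\widetilde{x}} \mid M[\widetilde{x}\leftarrow x] \mid (M[\widetilde{x}\leftarrow x])\langle B/x\rangle$, bags, sums. Reduction: $\beta$ to $M[\widetilde{x}\leftarrow x]\langle B/x\rangle$; expansion of $M[x_1,\dots,x_k\leftarrow x]\langle B/x\rangle$ into $\sum_{B_i\in\mathrm{PER}(B)}M\langle\!\langle B_i(1)/x_1\rangle\!\rangle\cdots\langle\!\langle B_i(k)/x_k\rangle\!\rangle$ when $|B|=k\ge1$ and $M$ is not a failure; $M\langle\!\langle N/x\rangle\!\rangle\longrightarrow M\{\!|N/x|\!\}$ when $\mathrm{head}(M)=x$; $M[x_1,\dots,x_k\leftarrow x]\langle B/x\rangle\longrightarrow\sum_{\mathrm{PER}(B)}\mathtt{fail}^{\widetilde{y}}$ when $k\ne|B|$ ($\widetilde{y}$ the free variables of $M$ minus $x_1..x_k$ plus those of $B$); consumption: $\mathtt{fail}^{\widetilde{x}}B\longrightarrow\sum\mathtt{fail}^{\widetilde{x}\cup\mathrm{fv}(B)}$, $(\mathtt{fail}^{\widetilde{x}\cup\widetilde{y}}[\widetilde{x}\leftarrow x])\langle B/x\rangle\longrightarrow\sum\mathtt{fail}^{\widetilde{y}\cup\mathrm{fv}(B)}$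 (when $|B|+|\widetilde{x}|\ne0$), $\mathtt{fail}^{\widetilde{y}\cup x}\langle\!\langle N/x\rangle\!\rangle\longrightarrow\mathtt{fail}^{\widetilde{y}\cup\mathrm{fv}(N)}$; closure under term contexts ($[\cdot]B$, $[\cdot]\langle\!\langle N/x\rangle\!\rangle$, $[\cdot][\widetilde{x}\leftarrow x]$, $[\cdot][\leftarrow x]\langle\mathtt{1}/x\rangle$) and sum contexts. $\models$ is well-formedness: built on the intersection type system with sharing, allowing mismatches of bag sizes in application and explicit substitution, and typing $\mathtt{fail}^{\widetilde{x}}$ with any type when $\mathrm{dom}(\Gamma)=\widetilde{x}$. -}

module Defs where

open import Data.Nat using (ℕ; zero; suc; _+_; _≤_; _≡ᵇ_)
open import Data.Bool using (Bool; true; false; if_then_else_; not)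
open import Data.List using (List; []; _∷_; _++_; [_]; length; foldl; zip; filterᵇ)
open import Data.Bool.ListAction using (any)
import Data.List as List
open import Data.List.NonEmpty as List⁺ using (List⁺; _∷_; _∷⁺_)
open import Data.List.Membership.Propositional using (_∈_; _∉_)
open import Data.List.Relation.Binary.Disjoint.Propositional using (Disjoint)
open import Data.List.Relation.Unary.Unique.Propositional using (Unique)
open import Data.List.Relation.Binary.Permutation.Propositional using (_↭_)
open import Data.Product using (_×_; _,_; proj₁; proj₂)
open import Relation.Binary.PropositionalEquality using (_≡_; _≢_)

Var : Set
Var = ℕ

data Term : Set
data Bag : Set

data Term where
  var   : Var → Term
  lam   : Var → Term → List Var → Term            -- lam x M xs   =  λx.(M[xs←x])
  app   : Term → Bag → Term
  lsub  : Term → Term → Var → Term                -- lsub M N x   =  M⟨⟨N/x⟩⟩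
  fail  : List Var → Term
  share : Term → List Var → Var → Term            -- share M xs x =  M[xs←x]
  esub  : Term → List Var → Var → Bag → Term      -- esub M xs x B = (M[xs←x])⟨B/x⟩

data Bag where
  one : Bag
  _∷_ : Term → Bag → Bag

data Expr : Set where
  ⟦_⟧ : Term → Expr
  _⊕_ : Expr → Expr → Expr

infixl 5 _⊕_

bagList : Bag → List Term
bagList one     = []
bagList (M ∷ B) = M ∷ bagList B

size : Bag → ℕ
size B = length (bagList B)

elemᵇ : Var → List Var → Bool
elemᵇ y xs = any (y ≡ᵇ_) xs

_∖_ : List Var → List Var → List Var
xs ∖ ys = filterᵇ (λ z → not (elemᵇ z ys)) xs

-- free variables (multisets represented as lists, ∪ as _++_)
fv  : Term → List Var
fvᵇ : Bag → List Var
fv (var x)          = [ x ]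
fv (lam x M xs)     = ((fv M ∖ xs) ++ [ x ]) ∖ [ x ]
fv (app M B)        = fv M ++ fvᵇ B
fv (lsub M N x)     = (fv M ∖ [ x ]) ++ fv N
fv (fail xs)        = xs
fv (share M xs x)   = (fv M ∖ xs) ++ [ x ]
fv (esub M xs x B)  = (((fv M ∖ xs) ++ [ x ]) ∖ [ x ]) ++ fvᵇ B
fvᵇ one     = []
fvᵇ (M ∷ B) = fv M ++ fvᵇ B

headSh : Term → List Var → Var → Term
headSh (var y) xs x = if elemᵇ y xs then var x else var y
headSh h       xs x = h

head : Term → Term
head (var x)         = var x
head (lam x M xs)    = lam x M xs
head (app M B)       = head M
head (lsub M N x)    = head M
head (fail xs)       = fail xs
head (share M xs x)  = headSh (head M) xs x
head (esub M xs x B) = headSh (head M) xs x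

-- Freshness side conditions express Barendregt's
-- variable convention (bound names of M on the head path are distinct
-- from x and from the free variables of N).
data _⟪_/_⟫≔_ : Term → Term → Var → Term → Set where
  lhs-var   : ∀ {N x} → var x ⟪ N / x ⟫≔ N
  lhs-app   : ∀ {M N x M' B} → M ⟪ N / x ⟫≔ M' → app M B ⟪ N / x ⟫≔ app M' B
  lhs-lsub  : ∀ {M N x M' L y} → x ≢ y → y ∉ fv N →
              M ⟪ N / x ⟫≔ M' → lsub M L y ⟪ N / x ⟫≔ lsub M' L y
  lhs-share : ∀ {M N x M' ys y} → x ≢ y → Disjoint ys (fv N) →
              M ⟪ N / x ⟫≔ M' → share M ys y ⟪ N / x ⟫≔ share M' ys y
  lhs-esub  : ∀ {M N x M' ys y B} → x ≢ y → Disjoint ys (fv N) → y ∉ fv N →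
              M ⟪ N / x ⟫≔ M' → esub M ys y B ⟪ N / x ⟫≔ esub M' ys y B

-- PER(B): all permutations (as index permutations, k! of them)
insertions : {A : Set} → A → List A → List⁺ (List A)
insertions x []       = (x ∷ []) ∷ []
insertions x (y ∷ ys) = (x ∷ y ∷ ys) ∷⁺ List⁺.map (y ∷_) (insertions x ys)

perms : {A : Set} → List A → List⁺ (List A)
perms []       = [] ∷ []
perms (x ∷ xs) = List⁺.concatMap (insertions x) (perms xs)

PER : Bag → List⁺ (List Term)
PER B = perms (bagList B)

sumL : Term → List Term → Expr
sumL M []       = ⟦ M ⟧
sumL M (N ∷ Ns) = ⟦ M ⟧ ⊕ sumL N Ns

Σ⁺ : List⁺ Term → Expr
Σ⁺ (M ∷ Ms) = sumL M Ms

mapE : (Term → Term) → Expr → Expr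
mapE f ⟦ M ⟧   = ⟦ f M ⟧
mapE f (𝕄 ⊕ ℕ) = mapE f 𝕄 ⊕ mapE f ℕ

linSubs : Term → List Term → List Var → Term
linSubs M Ns xs = foldl (λ acc p → lsub acc (proj₁ p) (proj₂ p)) M (zip Ns xs)

NotFail : Term → Set
NotFail M = ∀ ys → M ≢ fail ys

-- term contexts  C ::= [·]B | [·]⟨⟨N/x⟩⟩ | [·][xs←x] | [·][←x]⟨1/x⟩
data TCtx : Set where
  ∙app   : Bag → TCtx
  ∙lsub  : Term → Var → TCtx
  ∙share : List Var → Var → TCtx
  ∙weak1 : Var → TCtx

plug : TCtx → Term → Term
plug (∙app B)      M = app M B
plug (∙lsub N x)   M = lsub M N x
plug (∙share xs x) M = share M xs x
plug (∙weak1 x)    M = esub M [] x one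

data _≈ₛ_ : Expr → Expr → Set where
  ≈-refl  : ∀ {𝕄} → 𝕄 ≈ₛ 𝕄
  ≈-sym   : ∀ {𝕄 ℕ} → 𝕄 ≈ₛ ℕ → ℕ ≈ₛ 𝕄
  ≈-trans : ∀ {𝕄 ℕ 𝕃} → 𝕄 ≈ₛ ℕ → ℕ ≈ₛ 𝕃 → 𝕄 ≈ₛ 𝕃
  ≈-comm  : ∀ {𝕄 ℕ} → (𝕄 ⊕ ℕ) ≈ₛ (ℕ ⊕ 𝕄)
  ≈-assoc : ∀ {𝕄 ℕ 𝕃} → ((𝕄 ⊕ ℕ) ⊕ 𝕃) ≈ₛ (𝕄 ⊕ (ℕ ⊕ 𝕃))
  ≈-cong  : ∀ {𝕄 𝕄' ℕ ℕ'} → 𝕄 ≈ₛ 𝕄' → ℕ ≈ₛ ℕ' → (𝕄 ⊕ ℕ) ≈ₛ (𝕄' ⊕ ℕ')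

infix 4 _⟶_

data _⟶_ : Expr → Expr → Set where
  RS-Beta : ∀ {x M xs B} →
    ⟦ app (lam x M xs) B ⟧ ⟶ ⟦ esub M xs x B ⟧
  RS-ExSub : ∀ {M xs x B} →
    NotFail M → size B ≡ length xs → 1 ≤ length xs →
    Disjoint xs (fvᵇ B) →                                   -- Barendregt convention
    ⟦ esub M xs x B ⟧ ⟶ Σ⁺ (List⁺.map (λ Bi → linSubs M Bi xs) (PER B))
  RS-LinFetch : ∀ {M N x M'} →
    head M ≡ var x → M ⟪ N / x ⟫≔ M' →
    ⟦ lsub M N x ⟧ ⟶ ⟦ M' ⟧
  RS-Fail : ∀ {M xs x B} →
    length xs ≢ size B →
    ⟦ esub M xs x B ⟧ ⟶ Σ⁺ (List⁺.map (λ _ → fail ((fv M ∖ xs) ++ fvᵇ B)) (PER B))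
  RS-Cons1 : ∀ {ys B} →
    ⟦ app (fail ys) B ⟧ ⟶ Σ⁺ (List⁺.map (λ _ → fail (ys ++ fvᵇ B)) (PER B))
  RS-Cons2 : ∀ {zs xs ys x B} →
    zs ↭ (xs ++ ys) → size B + length xs ≢ 0 →
    ⟦ esub (fail zs) xs x B ⟧ ⟶ Σ⁺ (List⁺.map (λ _ → fail (ys ++ fvᵇ B)) (PER B))
  RS-Cons3 : ∀ {zs ys x N} →
    zs ↭ (x ∷ ys) →
    ⟦ lsub (fail zs) N x ⟧ ⟶ ⟦ fail (ys ++ fv N) ⟧
  RS-TCont : ∀ {M 𝕄'} (C : TCtx) →
    ⟦ M ⟧ ⟶ 𝕄' → ⟦ plug C M ⟧ ⟶ mapE (plug C) 𝕄'
  RS-ECont-l : ∀ {𝕄 𝕄' ℕ} → 𝕄 ⟶ 𝕄' → (𝕄 ⊕ ℕ) ⟶ (𝕄' ⊕ ℕ)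
  RS-ECont-r : ∀ {𝕄 𝕄' ℕ} → 𝕄 ⟶ 𝕄' → (ℕ ⊕ 𝕄) ⟶ (ℕ ⊕ 𝕄')
  RS-AC : ∀ {𝕄 𝕄₁ 𝕄₂ 𝕄'} → 𝕄 ≈ₛ 𝕄₁ → 𝕄₁ ⟶ 𝕄₂ → 𝕄₂ ≈ₛ 𝕄' → 𝕄 ⟶ 𝕄'

data Ty : Set
data MTy : Set

data Ty where
  unit : Ty
  _⇒_  : MTy → Ty → Ty

data MTy where
  ω : MTy
  ⋀ : List⁺ Ty → MTy

_^_ : Ty → ℕ → MTy
σ ^ zero  = ω
σ ^ suc k = ⋀ (σ ∷ List.replicate k σ)

data CTy : Set where
  strict : Ty → CTy
  multi  : MTy → CTy

Ctx : Set
Ctx = List (Var × CTy)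

dom : Ctx → List Var
dom = List.map proj₁

-- Well-formedness  ⊨  (intersection types with sharing, allowing bag-size
-- mismatches in application and explicit substitution, and failure)

infix 3 _⊨_∶_ _⊨ᵇ_∶_ _⊨ₑ_∶_

data _⊨_∶_ : Ctx → Term → Ty → Set
data _⊨ᵇ_∶_ : Ctx → Bag → MTy → Set

data _⊨_∶_ where
  F-var : ∀ {x σ} → [ (x , strict σ) ] ⊨ var x ∶ σ
  F-abs-sh : ∀ {Γ x M xs σ k τ} →
    ((x , multi (σ ^ k)) ∷ Γ) ⊨ share M xs x ∶ τ → x ∉ dom Γ →
    Γ ⊨ lam x M xs ∶ ((σ ^ k) ⇒ τ)
  F-app : ∀ {Γ Δ M B σ j k τ} →
    Γ ⊨ M ∶ ((σ ^ j) ⇒ τ) → Δ ⊨ᵇ B ∶ (σ ^ k) → Disjoint (dom Γ) (dom Δ) →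
    (Γ ++ Δ) ⊨ app M B ∶ τ
  F-share : ∀ {Γ x xs M σ τ} →
    (List.map (λ y → (y , strict σ)) xs ++ Γ) ⊨ M ∶ τ → x ∉ dom Γ → length xs ≢ 0 →
    ((x , multi (σ ^ length xs)) ∷ Γ) ⊨ share M xs x ∶ τ
  F-weak : ∀ {Γ x M τ} →
    Γ ⊨ M ∶ τ → x ∉ dom Γ →
    ((x , multi ω) ∷ Γ) ⊨ share M [] x ∶ τ
  F-ex-sub : ∀ {Γ Δ x xs M B σ k j τ} →
    ((x , multi (σ ^ k)) ∷ Γ) ⊨ share M xs x ∶ τ → Δ ⊨ᵇ B ∶ (σ ^ j) →
    Disjoint (dom Γ) (dom Δ) →
    (Γ ++ Δ) ⊨ esub M xs x B ∶ τ
  F-ex-lin-sub : ∀ {Γ Δ x M N σ τ} →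
    ((x , strict σ) ∷ Γ) ⊨ M ∶ τ → Δ ⊨ N ∶ σ → Disjoint (dom Γ) (dom Δ) →
    (Γ ++ Δ) ⊨ lsub M N x ∶ τ
  F-fail : ∀ {Γ xs τ} →
    Unique (dom Γ) → dom Γ ↭ xs →
    Γ ⊨ fail xs ∶ τ
  F-exch : ∀ {Γ Δ M τ} → Γ ↭ Δ → Γ ⊨ M ∶ τ → Δ ⊨ M ∶ τ

data _⊨ᵇ_∶_ where
  F-one : ∀ {σ} → [] ⊨ᵇ one ∶ (σ ^ 0)
  F-bag : ∀ {Γ Δ M B σ k} →
    Γ ⊨ M ∶ σ → Δ ⊨ᵇ B ∶ (σ ^ k) → Disjoint (dom Γ) (dom Δ) →
    (Γ ++ Δ) ⊨ᵇ (M ∷ B) ∶ (σ ^ suc k)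
  F-exchᵇ : ∀ {Γ Δ B π} → Γ ↭ Δ → Γ ⊨ᵇ B ∶ π → Δ ⊨ᵇ B ∶ π

data _⊨ₑ_∶_ : Ctx → Expr → Ty → Set where
  F-term : ∀ {Γ M τ} → Γ ⊨ M ∶ τ → Γ ⊨ₑ ⟦ M ⟧ ∶ τ
  F-sum  : ∀ {Γ 𝕄 ℕ σ} → Γ ⊨ₑ 𝕄 ∶ σ → Γ ⊨ₑ ℕ ∶ σ → Γ ⊨ₑ (𝕄 ⊕ ℕ) ∶ σ

-- A well-formedness derivation is rigid about its context: the variables of Γ are distinct and
-- are, up to permutation, exactly the free variables of the term.  So every failure-producing
-- step yields a fail annotated by a permutation of dom Γ, which F-fail accepts at any type.
-- β hands the abstraction's typing of the sharing body to the explicit substitution.  Expanding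
-- M[x₁…x_k←x]⟨B/x⟩ is well formed summand by summand: each permutation of B is a list of
-- σ-typed terms over a permuted context, consumed one ⟨⟨Nᵢ/xᵢ⟩⟩ at a time.  A linear head
-- substitution replaces the unique leaf for x on the head path by the derivation of N.
-- Exchange commutes with all of these, and sums, contexts and AC rearrangement are componentwise.

module Submission where

open import Defs
open import Data.Bool using (not; true; false; T)
open import Data.Bool.Properties using (T-not-≡)
open import Data.Empty using (⊥-elim)
open import Data.Nat using (zero; suc; _≡ᵇ_)
open import Data.Nat.Properties using (suc-injective; ≡ᵇ⇒≡; ≡⇒≡ᵇ)
open import Data.List using (List; []; _∷_; _++_; [_]; length; map)
open import Data.List.NonEmpty as List⁺ using (List⁺)
open import Data.List.NonEmpty.Properties using (toList->>=)
open import Data.List.Properties using (map-++; ++-assoc; ++-identityʳ; filter-all; filter-none; filter-++)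
open import Data.List.Membership.Propositional using (_∈_; _∉_; find)
open import Data.List.Membership.Propositional.Properties
  using (∈-++⁻; ∈-++⁺ˡ; ∈-++⁺ʳ; ∈-∃++; ∈-map⁺; ∈-map⁻; ∈-concatMap⁻)
open import Data.List.Relation.Unary.Any using (here; there)
import Data.List.Relation.Unary.Any as Any
open import Data.List.Relation.Unary.Any.Properties using (any⁺; any⁻)
import Data.List.Relation.Unary.All as All
import Data.List.Relation.Unary.All.Properties as Allₚ
open import Data.List.Relation.Binary.Disjoint.Propositional using (Disjoint)
open import Data.List.Relation.Unary.Unique.Propositional using (Unique; []; _∷_)
import Data.List.Relation.Unary.Unique.Propositional.Properties as Unique
open import Data.List.Relation.Binary.Permutation.Propositional
  using (_↭_; refl; prep; swap; trans; ↭-sym; ↭-trans; ↭⇒↭ₛ; module PermutationReasoning)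
open import Data.List.Relation.Binary.Permutation.Propositional.Properties
  using ( ∈-resp-↭; map⁺; ++⁺; ++⁺ˡ; ++⁺ʳ; ++-comm; shift; shifts; drop-∷; ↭-length; ↭-singleton-inv
        ; filter-↭)
import Data.List.Relation.Binary.Permutation.Setoid.Properties as PermutationSetoid
open import Data.Product using (_×_; _,_; proj₁; proj₂; ∃)
open import Data.Sum using (inj₁; inj₂)
open import Function using (_∘_; Equivalence)
open import Relation.Nullary using (¬_)
open import Relation.Nullary.Decidable using (T?)
open import Relation.Binary.PropositionalEquality
  using (_≡_; _≢_; refl; sym; cong; cong₂; subst; setoid) renaming (trans to ≡-trans)

private variable
  A : Set

Unique-resp-↭ : {xs ys : List A} → xs ↭ ys → Unique xs → Unique ys
Unique-resp-↭ xs↭ys = PermutationSetoid.Unique-resp-↭ (setoid _) (↭⇒↭ₛ xs↭ys)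

Unique-head : ∀ {x : A} {xs} → Unique (x ∷ xs) → x ∉ xs
Unique-head (x≢xs ∷ _) x∈xs = All.lookup x≢xs x∈xs refl

Unique-tail : ∀ {x : A} {xs} → Unique (x ∷ xs) → Unique xs
Unique-tail (_ ∷ u) = u

Unique-++⁻ˡ : ∀ (xs : List A) {ys} → Unique (xs ++ ys) → Unique xs
Unique-++⁻ˡ []       _             = []
Unique-++⁻ˡ (x ∷ xs) (x≢xsys ∷ u) = Allₚ.++⁻ˡ xs x≢xsys ∷ Unique-++⁻ˡ xs u

Unique-++⁻ʳ : ∀ (xs : List A) {ys} → Unique (xs ++ ys) → Unique ys
Unique-++⁻ʳ []       u       = u
Unique-++⁻ʳ (_ ∷ xs) (_ ∷ u) = Unique-++⁻ʳ xs u

Unique-++⇒Disjoint : ∀ (xs : List A) {ys} → Unique (xs ++ ys) → Disjoint xs ys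
Unique-++⇒Disjoint (_ ∷ xs) (x≢xsys ∷ _) (here refl , v∈ys) = All.lookup x≢xsys (∈-++⁺ʳ xs v∈ys) refl
Unique-++⇒Disjoint (_ ∷ xs) (_ ∷ u)      (there v∈xs , v∈ys) = Unique-++⇒Disjoint xs u (v∈xs , v∈ys)

Disjoint-resp-↭ : {xs xs' ys ys' : List A} → xs ↭ xs' → ys ↭ ys' → Disjoint xs ys → Disjoint xs' ys'
Disjoint-resp-↭ p q xs#ys (v∈xs' , v∈ys') = xs#ys (∈-resp-↭ (↭-sym p) v∈xs' , ∈-resp-↭ (↭-sym q) v∈ys')

Disjoint-++⁺ˡ : ∀ {xs ys zs : List A} → Disjoint xs zs → Disjoint ys zs → Disjoint (xs ++ ys) zs
Disjoint-++⁺ˡ {xs = xs} xs#zs ys#zs (v∈xsys , v∈zs) with ∈-++⁻ xs v∈xsys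
... | inj₁ v∈xs = xs#zs (v∈xs , v∈zs)
... | inj₂ v∈ys = ys#zs (v∈ys , v∈zs)

Disjoint-[_]ˡ : ∀ {x : A} {ys} → x ∉ ys → Disjoint [ x ] ys
Disjoint-[ x∉ys ]ˡ (here refl , x∈ys) = x∉ys x∈ys

↭-++-cancelˡ : ∀ (xs : List A) {ys zs} → xs ++ ys ↭ xs ++ zs → ys ↭ zs
↭-++-cancelˡ []       p = p
↭-++-cancelˡ (_ ∷ xs) p = ↭-++-cancelˡ xs (drop-∷ p)

∈-∷-≢ : ∀ {x y : A} {xs} → x ≢ y → x ∈ y ∷ xs → x ∈ xs
∈-∷-≢ x≢y (here x≡y)  = ⊥-elim (x≢y x≡y)
∈-∷-≢ _   (there x∈xs) = x∈xs

∈-++-∉ˡ : ∀ {x : A} {xs ys} → x ∉ xs → x ∈ xs ++ ys → x ∈ ys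
∈-++-∉ˡ {xs = xs} x∉xs x∈xsys with ∈-++⁻ xs x∈xsys
... | inj₁ x∈xs = ⊥-elim (x∉xs x∈xs)
... | inj₂ x∈ys = x∈ys

insertions-↭ : ∀ (x : A) ys {zs} → zs ∈ List⁺.toList (insertions x ys) → zs ↭ x ∷ ys
insertions-↭ x []       (here refl) = refl
insertions-↭ x (y ∷ ys) (here refl) = refl
insertions-↭ x (y ∷ ys) (there zs∈) with ∈-map⁻ (y ∷_) zs∈
... | zs' , zs'∈ , refl = ↭-trans (prep y (insertions-↭ x ys zs'∈)) (swap y x refl)

perms-↭ : ∀ (xs : List A) {ys} → ys ∈ List⁺.toList (perms xs) → ys ↭ xs
perms-↭ []       (here refl) = refl
perms-↭ (x ∷ xs) {ys} ys∈
  with find (∈-concatMap⁻ (List⁺.toList ∘ insertions x)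
              (subst (ys ∈_) (sym (toList->>= (insertions x) (perms xs))) ys∈))
... | zs , zs∈ , ys∈' = ↭-trans (insertions-↭ x zs ys∈') (prep x (perms-↭ xs zs∈))

elemᵇ⇒∈ : ∀ {y} xs → T (elemᵇ y xs) → y ∈ xs
elemᵇ⇒∈ {y} xs t = Any.map (λ {z} → ≡ᵇ⇒≡ y z) (any⁻ (y ≡ᵇ_) xs t)

∈⇒elemᵇ : ∀ {y xs} → y ∈ xs → T (elemᵇ y xs)
∈⇒elemᵇ {y} y∈xs = any⁺ (y ≡ᵇ_) (Any.map (λ {z} → ≡⇒≡ᵇ y z) y∈xs)

∉⇒kept : ∀ {z} ys → z ∉ ys → T (not (elemᵇ z ys))
∉⇒kept {z} ys z∉ys with elemᵇ z ys in eq
... | true  = z∉ys (elemᵇ⇒∈ ys (subst T (sym eq) _))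
... | false = _

∈⇒removed : ∀ {z ys} → z ∈ ys → ¬ T (not (elemᵇ z ys))
∈⇒removed z∈ys kept = subst T (Equivalence.to T-not-≡ kept) (∈⇒elemᵇ z∈ys)

∖-cancel : ∀ {xs} ys {zs} → xs ↭ ys ++ zs → Disjoint ys zs → xs ∖ ys ↭ zs
∖-cancel {xs} ys {zs} xs↭yszs ys#zs = begin
  xs ∖ ys               ↭⟨ filter-↭ kept? xs↭yszs ⟩
  (ys ++ zs) ∖ ys       ≡⟨ filter-++ kept? ys zs ⟩
  ys ∖ ys ++ zs ∖ ys    ≡⟨ cong₂ _++_ (filter-none kept? {ys} (All.tabulate ∈⇒removed))
                                      (filter-all kept? {zs} (All.tabulate λ z∈zs →
                                        ∉⇒kept ys λ z∈ys → ys#zs (z∈ys , z∈zs))) ⟩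
  zs                    ∎
  where
  open PermutationReasoning
  kept? = λ z → T? (not (elemᵇ z ys))

UniqueDom : Ctx → Set
UniqueDom Γ = Unique (dom Γ)

dom-++ : ∀ Γ Δ → dom (Γ ++ Δ) ≡ dom Γ ++ dom Δ
dom-++ = map-++ proj₁

dom-↭ : ∀ {Γ Δ} → Γ ↭ Δ → dom Γ ↭ dom Δ
dom-↭ = map⁺ proj₁

↭-dom-++ : ∀ {xs ys} Γ Δ → xs ↭ dom Γ → ys ↭ dom Δ → xs ++ ys ↭ dom (Γ ++ Δ)
↭-dom-++ Γ Δ p q = subst (_ ↭_) (sym (dom-++ Γ Δ)) (++⁺ p q)

UniqueDom-resp-↭ : ∀ {Γ Δ} → Γ ↭ Δ → UniqueDom Γ → UniqueDom Δ
UniqueDom-resp-↭ Γ↭Δ = Unique-resp-↭ (dom-↭ Γ↭Δ)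

UniqueDom-++⁺ : ∀ {Γ Δ} → UniqueDom Γ → UniqueDom Δ → Disjoint (dom Γ) (dom Δ) → UniqueDom (Γ ++ Δ)
UniqueDom-++⁺ {Γ} {Δ} uΓ uΔ Γ#Δ = subst Unique (sym (dom-++ Γ Δ)) (Unique.++⁺ uΓ uΔ Γ#Δ)

UniqueDom-++⁻ˡ : ∀ Γ {Δ} → UniqueDom (Γ ++ Δ) → UniqueDom Γ
UniqueDom-++⁻ˡ Γ {Δ} u = Unique-++⁻ˡ (dom Γ) (subst Unique (dom-++ Γ Δ) u)

UniqueDom-++⁻ʳ : ∀ Γ {Δ} → UniqueDom (Γ ++ Δ) → UniqueDom Δ
UniqueDom-++⁻ʳ Γ {Δ} u = Unique-++⁻ʳ (dom Γ) (subst Unique (dom-++ Γ Δ) u)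

UniqueDom-++⇒Disjoint : ∀ Γ {Δ} → UniqueDom (Γ ++ Δ) → Disjoint (dom Γ) (dom Δ)
UniqueDom-++⇒Disjoint Γ {Δ} u = Unique-++⇒Disjoint (dom Γ) (subst Unique (dom-++ Γ Δ) u)

strictCtx : Ty → List Var → Ctx
strictCtx σ = map (λ y → y , strict σ)

dom-strictCtx-++ : ∀ σ ys Γ → dom (strictCtx σ ys ++ Γ) ≡ ys ++ dom Γ
dom-strictCtx-++ σ []       Γ = refl
dom-strictCtx-++ σ (y ∷ ys) Γ = cong (y ∷_) (dom-strictCtx-++ σ ys Γ)

-- Well-formed terms and their contexts

⊨-UniqueDom : ∀ {Γ M τ} → Γ ⊨ M ∶ τ → UniqueDom Γ
⊨ᵇ-UniqueDom : ∀ {Γ B π} → Γ ⊨ᵇ B ∶ π → UniqueDom Γ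
⊨-UniqueDom F-var                      = All.[] ∷ []
⊨-UniqueDom (F-abs-sh d _)             = Unique-tail (⊨-UniqueDom d)
⊨-UniqueDom (F-app d dB Γ#Δ)           = UniqueDom-++⁺ (⊨-UniqueDom d) (⊨ᵇ-UniqueDom dB) Γ#Δ
⊨-UniqueDom (F-share {xs = xs} {σ = σ} d x∉Γ _) =
  Allₚ.¬Any⇒All¬ _ x∉Γ ∷ UniqueDom-++⁻ʳ (strictCtx σ xs) (⊨-UniqueDom d)
⊨-UniqueDom (F-weak d x∉Γ)             = Allₚ.¬Any⇒All¬ _ x∉Γ ∷ ⊨-UniqueDom d
⊨-UniqueDom (F-ex-sub d dB Γ#Δ)        = UniqueDom-++⁺ (Unique-tail (⊨-UniqueDom d)) (⊨ᵇ-UniqueDom dB) Γ#Δ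
⊨-UniqueDom (F-ex-lin-sub d dN Γ#Δ)    = UniqueDom-++⁺ (Unique-tail (⊨-UniqueDom d)) (⊨-UniqueDom dN) Γ#Δ
⊨-UniqueDom (F-fail u _)               = u
⊨-UniqueDom (F-exch Γ↭Δ d)             = UniqueDom-resp-↭ Γ↭Δ (⊨-UniqueDom d)
⊨ᵇ-UniqueDom F-one                     = []
⊨ᵇ-UniqueDom (F-bag d dB Γ#Δ)          = UniqueDom-++⁺ (⊨-UniqueDom d) (⊨ᵇ-UniqueDom dB) Γ#Δ
⊨ᵇ-UniqueDom (F-exchᵇ Γ↭Δ dB)          = UniqueDom-resp-↭ Γ↭Δ (⊨ᵇ-UniqueDom dB)

fv-↭-dom : ∀ {Γ M τ} → Γ ⊨ M ∶ τ → fv M ↭ dom Γ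
fvᵇ-↭-dom : ∀ {Γ B π} → Γ ⊨ᵇ B ∶ π → fvᵇ B ↭ dom Γ
bound-fv : ∀ {x c Γ M τ} → ((x , c) ∷ Γ) ⊨ M ∶ τ → fv M ∖ [ x ] ↭ dom Γ
shared-fv : ∀ {σ xs Γ M τ} → (strictCtx σ xs ++ Γ) ⊨ M ∶ τ → fv M ∖ xs ↭ dom Γ
fv-↭-dom F-var                          = refl
fv-↭-dom (F-abs-sh d _)                 = bound-fv d
fv-↭-dom (F-app {Γ} {Δ} d dB _)         = ↭-dom-++ Γ Δ (fv-↭-dom d) (fvᵇ-↭-dom dB)
fv-↭-dom (F-share {x = x} d _ _)  = ↭-trans (++-comm _ [ x ]) (prep x (shared-fv d))
fv-↭-dom (F-weak {x = x} d _)     = ↭-trans (++-comm _ [ x ]) (prep x (∖-cancel [] (fv-↭-dom d) λ ()))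
fv-↭-dom (F-ex-sub {Γ} {Δ} d dB _)      = ↭-dom-++ Γ Δ (bound-fv d) (fvᵇ-↭-dom dB)
fv-↭-dom (F-ex-lin-sub {Γ} {Δ} d dN _)  = ↭-dom-++ Γ Δ (bound-fv d) (fv-↭-dom dN)
fv-↭-dom (F-fail _ Γ↭xs)                = ↭-sym Γ↭xs
fv-↭-dom (F-exch Γ↭Δ d)                 = ↭-trans (fv-↭-dom d) (dom-↭ Γ↭Δ)
fvᵇ-↭-dom F-one                         = refl
fvᵇ-↭-dom (F-bag {Γ} {Δ} d dB _)        = ↭-dom-++ Γ Δ (fv-↭-dom d) (fvᵇ-↭-dom dB)
fvᵇ-↭-dom (F-exchᵇ Γ↭Δ dB)              = ↭-trans (fvᵇ-↭-dom dB) (dom-↭ Γ↭Δ)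
bound-fv {x = x} d = ∖-cancel [ x ] (fv-↭-dom d) Disjoint-[ Unique-head (⊨-UniqueDom d) ]ˡ
shared-fv {σ} {xs} {Γ} d = ∖-cancel xs
  (subst (_ ↭_) (dom-strictCtx-++ σ xs Γ) (fv-↭-dom d))
  (Unique-++⇒Disjoint xs (subst Unique (dom-strictCtx-++ σ xs Γ) (⊨-UniqueDom d)))

-- Inversion

⋀-injective : ∀ {σs σs'} → ⋀ σs ≡ ⋀ σs' → σs ≡ σs'
⋀-injective refl = refl

^-base-injective : ∀ {σ σ' k n} → σ ^ k ≡ σ' ^ suc n → σ ≡ σ'
^-base-injective {k = zero}  ()
^-base-injective {k = suc k} eq = cong List⁺.head (⋀-injective eq)

-- The base of ω = σ ^ 0 is arbitrary: an abstraction of type ω ⇒ τ accepts a bag of any strict type.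
^-rebase : ∀ {σ σ' j} k → σ ^ j ≡ σ' ^ k → σ' ^ k ≡ σ ^ k
^-rebase zero    _  = refl
^-rebase (suc k) eq = cong (_^ suc k) (sym (^-base-injective eq))

⇒-injective : ∀ {π π' τ τ'} → (π ⇒ τ) ≡ (π' ⇒ τ') → π ≡ π' × τ ≡ τ'
⇒-injective refl = refl , refl

multi-injective : ∀ {π π'} → multi π ≡ multi π' → π ≡ π'
multi-injective refl = refl

↭-∷-cancel : ∀ {Θ x c c' Γ Δ} → UniqueDom Θ → Θ ↭ (x , c) ∷ Γ → Θ ↭ (x , c') ∷ Δ →
             c ≡ c' × Γ ↭ Δ
↭-∷-cancel u p q with ∈-resp-↭ (↭-trans (↭-sym p) q) (here refl)
... | here refl = refl , drop-∷ (↭-trans (↭-sym p) q)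
... | there x∈Δ = ⊥-elim (Unique-head (UniqueDom-resp-↭ q u) (∈-map⁺ proj₁ x∈Δ))

data ShareInversion (Θ : Ctx) (M : Term) (xs : List Var) (x : Var) (τ : Ty) : Set where
  shared   : ∀ Γ σ → Θ ↭ (x , multi (σ ^ length xs)) ∷ Γ → (strictCtx σ xs ++ Γ) ⊨ M ∶ τ →
             length xs ≢ 0 → ShareInversion Θ M xs x τ
  weakened : ∀ Γ → xs ≡ [] → Θ ↭ (x , multi ω) ∷ Γ → Γ ⊨ M ∶ τ → x ∉ dom Γ →
             ShareInversion Θ M xs x τ

share-inv : ∀ {Θ M xs x τ} → Θ ⊨ share M xs x ∶ τ → ShareInversion Θ M xs x τ
share-inv (F-share d _ xs≢[])   = shared _ _ refl d xs≢[]
share-inv (F-weak d x∉Γ)        = weakened _ refl refl d x∉Γ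
share-inv (F-exch Θ↭Θ' d) with share-inv d
... | shared Γ σ p d' xs≢[]     = shared Γ σ (↭-trans (↭-sym Θ↭Θ') p) d' xs≢[]
... | weakened Γ xs≡[] p d' x∉Γ = weakened Γ xs≡[] (↭-trans (↭-sym Θ↭Θ') p) d' x∉Γ

data LamInversion (Θ : Ctx) (x : Var) (M : Term) (xs : List Var) (ρ : Ty) : Set where
  abstracted : ∀ Γ σ k τ → ρ ≡ ((σ ^ k) ⇒ τ) → Θ ↭ Γ →
               ((x , multi (σ ^ k)) ∷ Γ) ⊨ share M xs x ∶ τ → LamInversion Θ x M xs ρ

lam-inv : ∀ {Θ x M xs ρ} → Θ ⊨ lam x M xs ∶ ρ → LamInversion Θ x M xs ρ
lam-inv (F-abs-sh d _) = abstracted _ _ _ _ refl refl d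
lam-inv (F-exch Θ↭Θ' d) with lam-inv d
... | abstracted Γ σ k τ eq p d' = abstracted Γ σ k τ eq (↭-trans (↭-sym Θ↭Θ') p) d'

fail-inv : ∀ {Θ xs ρ} → Θ ⊨ fail xs ∶ ρ → dom Θ ↭ xs
fail-inv (F-fail _ Θ↭xs) = Θ↭xs
fail-inv (F-exch Θ↭Θ' d) = ↭-trans (↭-sym (dom-↭ Θ↭Θ')) (fail-inv d)

record PlugInversion (Θ : Ctx) (C : TCtx) (M : Term) (τ : Ty) : Set where
  constructor plugged
  field
    {Γ}    : Ctx
    {σ}    : Ty
    hole   : Γ ⊨ M ∶ σ
    refill : ∀ {M'} → Γ ⊨ M' ∶ σ → Θ ⊨ plug C M' ∶ τ

PlugInversion-exch : ∀ {Θ Θ' C M τ} → Θ ↭ Θ' → PlugInversion Θ C M τ → PlugInversion Θ' C M τ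
PlugInversion-exch Θ↭Θ' (plugged dM refill) = plugged dM (F-exch Θ↭Θ' ∘ refill)

plug-inv : ∀ C {Θ M τ} → Θ ⊨ plug C M ∶ τ → PlugInversion Θ C M τ
plug-inv C@(∙app _)     (F-exch Θ↭Θ' d) = PlugInversion-exch Θ↭Θ' (plug-inv C d)
plug-inv C@(∙lsub _ _)  (F-exch Θ↭Θ' d) = PlugInversion-exch Θ↭Θ' (plug-inv C d)
plug-inv C@(∙share _ _) (F-exch Θ↭Θ' d) = PlugInversion-exch Θ↭Θ' (plug-inv C d)
plug-inv C@(∙weak1 _)   (F-exch Θ↭Θ' d) = PlugInversion-exch Θ↭Θ' (plug-inv C d)
plug-inv (∙app B)      (F-app dM dB Γ#Δ)            = plugged dM λ d → F-app d dB Γ#Δ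
plug-inv (∙lsub N x)   (F-ex-lin-sub dM dN Γ#Δ)     = plugged dM λ d → F-ex-lin-sub d dN Γ#Δ
plug-inv (∙share xs x) (F-share dM x∉Γ xs≢[])       = plugged dM λ d → F-share d x∉Γ xs≢[]
plug-inv (∙share xs x) (F-weak dM x∉Γ)              = plugged dM λ d → F-weak d x∉Γ
plug-inv (∙weak1 x)    (F-ex-sub dSh dB Γ#Δ) with share-inv dSh
... | shared _ _ _ _ []≢[]       = ⊥-elim ([]≢[] refl)
... | weakened _ _ p dM x∉Γ      = plugged dM λ d → F-ex-sub (F-exch (↭-sym p) (F-weak d x∉Γ)) dB Γ#Δ

sumL-⊨ : ∀ {Γ τ} (f : A → Term) a as → (∀ b → b ∈ a ∷ as → Γ ⊨ f b ∶ τ) →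
         Γ ⊨ₑ sumL (f a) (map f as) ∶ τ
sumL-⊨ f a []        ⊨f = F-term (⊨f a (here refl))
sumL-⊨ f a (a' ∷ as) ⊨f = F-sum (F-term (⊨f a (here refl))) (sumL-⊨ f a' as λ b b∈ → ⊨f b (there b∈))

Σ⁺-⊨ : ∀ {Γ τ} (f : A → Term) (L : List⁺ A) → (∀ b → b ∈ List⁺.toList L → Γ ⊨ f b ∶ τ) →
       Γ ⊨ₑ Σ⁺ (List⁺.map f L) ∶ τ
Σ⁺-⊨ f (a List⁺.∷ as) = sumL-⊨ f a as

mapE-⊨ : ∀ {Γ Θ τ τ' 𝕄} (f : Term → Term) → (∀ {M} → Γ ⊨ M ∶ τ' → Θ ⊨ f M ∶ τ) →
         Γ ⊨ₑ 𝕄 ∶ τ' → Θ ⊨ₑ mapE f 𝕄 ∶ τ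
mapE-⊨ f ⊨f (F-term d)   = F-term (⊨f d)
mapE-⊨ f ⊨f (F-sum d d') = F-sum (mapE-⊨ f ⊨f d) (mapE-⊨ f ⊨f d')

≈ₛ-preserves-⊨ : ∀ {Γ τ 𝕄 ℕ} → 𝕄 ≈ₛ ℕ → Γ ⊨ₑ 𝕄 ∶ τ → Γ ⊨ₑ ℕ ∶ τ
≈ₛ-reflects-⊨  : ∀ {Γ τ 𝕄 ℕ} → 𝕄 ≈ₛ ℕ → Γ ⊨ₑ ℕ ∶ τ → Γ ⊨ₑ 𝕄 ∶ τ
≈ₛ-preserves-⊨ ≈-refl          d                     = d
≈ₛ-preserves-⊨ (≈-sym e)       d                     = ≈ₛ-reflects-⊨ e d
≈ₛ-preserves-⊨ (≈-trans e e')  d                     = ≈ₛ-preserves-⊨ e' (≈ₛ-preserves-⊨ e d)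
≈ₛ-preserves-⊨ ≈-comm          (F-sum a b)           = F-sum b a
≈ₛ-preserves-⊨ ≈-assoc         (F-sum (F-sum a b) c) = F-sum a (F-sum b c)
≈ₛ-preserves-⊨ (≈-cong e e')   (F-sum a b)           = F-sum (≈ₛ-preserves-⊨ e a) (≈ₛ-preserves-⊨ e' b)
≈ₛ-reflects-⊨  ≈-refl          d                     = d
≈ₛ-reflects-⊨  (≈-sym e)       d                     = ≈ₛ-preserves-⊨ e d
≈ₛ-reflects-⊨  (≈-trans e e')  d                     = ≈ₛ-reflects-⊨ e (≈ₛ-reflects-⊨ e' d)
≈ₛ-reflects-⊨  ≈-comm          (F-sum a b)           = F-sum b a
≈ₛ-reflects-⊨  ≈-assoc         (F-sum a (F-sum b c)) = F-sum (F-sum a b) c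
≈ₛ-reflects-⊨  (≈-cong e e')   (F-sum a b)           = F-sum (≈ₛ-reflects-⊨ e a) (≈ₛ-reflects-⊨ e' b)

-- Preservation by the reduction rules

infix 3 _⊨*_∶_

data _⊨*_∶_ : Ctx → List Term → Ty → Set where
  []  : ∀ {σ} → [] ⊨* [] ∶ σ
  _∷_ : ∀ {Γ Δ M Ms σ} → Γ ⊨ M ∶ σ → Δ ⊨* Ms ∶ σ → (Γ ++ Δ) ⊨* M ∷ Ms ∶ σ

⊨ᵇ⇒⊨* : ∀ {Δ B π σ j} → Δ ⊨ᵇ B ∶ π → π ≡ σ ^ j → ∃ λ Δ' → Δ' ↭ Δ × Δ' ⊨* bagList B ∶ σ
⊨ᵇ⇒⊨* F-one _ = [] , refl , []
⊨ᵇ⇒⊨* (F-bag {Γ} {k = k} d dB _) eq with ^-base-injective (sym eq)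
... | refl with ⊨ᵇ⇒⊨* {j = k} dB refl
... | Δ' , Δ'↭Δ , ds = Γ ++ Δ' , ++⁺ˡ Γ Δ'↭Δ , d ∷ ds
⊨ᵇ⇒⊨* (F-exchᵇ Δ↭Δ₁ dB) eq with ⊨ᵇ⇒⊨* dB eq
... | Δ' , Δ'↭Δ , ds = Δ' , ↭-trans Δ'↭Δ Δ↭Δ₁ , ds

⊨*-resp-↭ : ∀ {Δ Ms Ns σ} → Δ ⊨* Ms ∶ σ → Ms ↭ Ns → ∃ λ Δ' → Δ' ↭ Δ × Δ' ⊨* Ns ∶ σ
⊨*-resp-↭ ds refl = _ , refl , ds
⊨*-resp-↭ (_∷_ {Γ} d ds) (prep _ p) with ⊨*-resp-↭ ds p
... | Δ' , Δ'↭Δ , ds' = Γ ++ Δ' , ++⁺ˡ Γ Δ'↭Δ , d ∷ ds'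
⊨*-resp-↭ (_∷_ {Γ₁} d₁ (_∷_ {Γ₂} d₂ ds)) (swap _ _ p) with ⊨*-resp-↭ ds p
... | Δ' , Δ'↭Δ , ds' =
  Γ₂ ++ Γ₁ ++ Δ' , ↭-trans (shifts Γ₂ Γ₁) (++⁺ˡ Γ₁ (++⁺ˡ Γ₂ Δ'↭Δ)) , d₂ ∷ (d₁ ∷ ds')
⊨*-resp-↭ ds (trans p q) with ⊨*-resp-↭ ds p
... | Δ₁ , Δ₁↭Δ , ds₁ with ⊨*-resp-↭ ds₁ q
... | Δ₂ , Δ₂↭Δ₁ , ds₂ = Δ₂ , ↭-trans Δ₂↭Δ₁ Δ₁↭Δ , ds₂

linSubs-⊨ : ∀ {σ τ} xs {Γ Δ M Ns} → (strictCtx σ xs ++ Γ) ⊨ M ∶ τ → Δ ⊨* Ns ∶ σ →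
            length Ns ≡ length xs → UniqueDom ((strictCtx σ xs ++ Γ) ++ Δ) →
            (Γ ++ Δ) ⊨ linSubs M Ns xs ∶ τ
linSubs-⊨ []       {Γ} d [] _ _ = subst (_⊨ _ ∶ _) (sym (++-identityʳ Γ)) d
linSubs-⊨ {σ} {τ} (y ∷ ys) {Γ} {M = M} d (_∷_ {Γ₁} {Δ₂} {N} dN dNs) |Ns|≡ u =
  subst (_⊨ _ ∶ _) (++-assoc Γ Γ₁ Δ₂) (linSubs-⊨ ys d' dNs (suc-injective |Ns|≡) u')
  where
  Γ₀ = strictCtx σ ys ++ Γ
  u₀ : UniqueDom ((Γ₀ ++ Γ₁) ++ Δ₂)
  u₀ = subst UniqueDom (sym (++-assoc Γ₀ Γ₁ Δ₂)) (Unique-tail u)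
  d' : (strictCtx σ ys ++ (Γ ++ Γ₁)) ⊨ lsub M N y ∶ τ
  d' = subst (_⊨ _ ∶ _) (++-assoc (strictCtx σ ys) Γ Γ₁)
         (F-ex-lin-sub d dN (UniqueDom-++⇒Disjoint Γ₀ (UniqueDom-++⁻ˡ (Γ₀ ++ Γ₁) u₀)))
  u' : UniqueDom ((strictCtx σ ys ++ (Γ ++ Γ₁)) ++ Δ₂)
  u' = subst (λ Θ → UniqueDom (Θ ++ Δ₂)) (++-assoc (strictCtx σ ys) Γ Γ₁) u₀

beta-preserves-⊨ : ∀ {Θ x M xs B τ} → Θ ⊨ app (lam x M xs) B ∶ τ → Θ ⊨ esub M xs x B ∶ τ
beta-preserves-⊨ (F-exch Θ↭Θ' d) = F-exch Θ↭Θ' (beta-preserves-⊨ d)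
beta-preserves-⊨ {x = x} {M} {xs} {τ = τ} (F-app {Δ = Δ} dλ dB Γ#Δ) with lam-inv dλ
... | abstracted Γ₀ _ k _ eq Γ↭Γ₀ dSh with ⇒-injective eq
... | π≡ , refl =
  F-exch (++⁺ʳ Δ (↭-sym Γ↭Γ₀)) (F-ex-sub dSh' dB (Disjoint-resp-↭ (dom-↭ Γ↭Γ₀) refl Γ#Δ))
  where dSh' = subst (λ π → ((x , multi π) ∷ Γ₀) ⊨ share M xs x ∶ τ) (^-rebase k π≡) dSh

exSub-summand-⊨ : ∀ {Θ M y ys x B Bs τ} → Θ ⊨ esub M (y ∷ ys) x B ∶ τ → size B ≡ length (y ∷ ys) →
                  Disjoint (y ∷ ys) (fvᵇ B) → Bs ↭ bagList B → Θ ⊨ linSubs M Bs (y ∷ ys) ∶ τ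
exSub-summand-⊨ (F-exch Θ↭Θ' d) |B|≡ xs#B Bs↭B = F-exch Θ↭Θ' (exSub-summand-⊨ d |B|≡ xs#B Bs↭B)
exSub-summand-⊨ {y = y} {ys} (F-ex-sub {σ = σ} dSh dB Γ#Δ) |B|≡ xs#B Bs↭B with share-inv dSh
... | weakened _ () _ _ _
... | shared Γ₀ _ p dM _ with ↭-∷-cancel (⊨-UniqueDom dSh) refl p
... | c≡ , Γ↭Γ₀ with ^-base-injective (multi-injective c≡)
... | refl with ⊨ᵇ⇒⊨* {σ = σ} dB refl
... | Δ' , Δ'↭Δ , ds with ⊨*-resp-↭ ds (↭-sym Bs↭B)
... | Δ'' , Δ''↭Δ' , ds' =
  F-exch (++⁺ (↭-sym Γ↭Γ₀) Δ''↭Δ) (linSubs-⊨ (y ∷ ys) dM ds' (≡-trans (↭-length Bs↭B) |B|≡) u)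
  where
  Δ''↭Δ = ↭-trans Δ''↭Δ' Δ'↭Δ
  xs#Δ'' : Disjoint (y ∷ ys) (dom Δ'')
  xs#Δ'' = Disjoint-resp-↭ refl (↭-trans (fvᵇ-↭-dom dB) (dom-↭ (↭-sym Δ''↭Δ))) xs#B
  Γ₀#Δ'' : Disjoint (dom Γ₀) (dom Δ'')
  Γ₀#Δ'' = Disjoint-resp-↭ (dom-↭ Γ↭Γ₀) (dom-↭ (↭-sym Δ''↭Δ)) Γ#Δ
  u : UniqueDom ((strictCtx σ (y ∷ ys) ++ Γ₀) ++ Δ'')
  u = UniqueDom-++⁺ {strictCtx σ (y ∷ ys) ++ Γ₀} (⊨-UniqueDom dM)
        (UniqueDom-resp-↭ (↭-sym Δ''↭Δ) (⊨ᵇ-UniqueDom dB))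
        (subst (λ xs → Disjoint xs (dom Δ'')) (sym (dom-strictCtx-++ σ (y ∷ ys) Γ₀))
               (Disjoint-++⁺ˡ xs#Δ'' Γ₀#Δ''))

share-body-fv : ∀ {x c Γ M xs τ} → ((x , c) ∷ Γ) ⊨ share M xs x ∶ τ → fv M ∖ xs ↭ dom Γ
share-body-fv {x} {M = M} {xs} d = drop-∷ (↭-trans (++-comm [ x ] (fv M ∖ xs)) (fv-↭-dom d))

fail-preserves-⊨ : ∀ {Θ M xs x B τ} → Θ ⊨ esub M xs x B ∶ τ → Θ ⊨ fail ((fv M ∖ xs) ++ fvᵇ B) ∶ τ
fail-preserves-⊨ (F-exch Θ↭Θ' d) = F-exch Θ↭Θ' (fail-preserves-⊨ d)
fail-preserves-⊨ d@(F-ex-sub {Γ} {Δ} dSh dB _) =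
  F-fail (⊨-UniqueDom d) (↭-sym (↭-dom-++ Γ Δ (share-body-fv dSh) (fvᵇ-↭-dom dB)))

cons1-preserves-⊨ : ∀ {Θ ys B τ} → Θ ⊨ app (fail ys) B ∶ τ → Θ ⊨ fail (ys ++ fvᵇ B) ∶ τ
cons1-preserves-⊨ d = F-fail (⊨-UniqueDom d) (↭-sym (fv-↭-dom d))

cons2-preserves-⊨ : ∀ {Θ zs xs ys x B τ} → zs ↭ xs ++ ys → Θ ⊨ esub (fail zs) xs x B ∶ τ →
                    Θ ⊨ fail (ys ++ fvᵇ B) ∶ τ
cons2-preserves-⊨ zs↭ (F-exch Θ↭Θ' d) = F-exch Θ↭Θ' (cons2-preserves-⊨ zs↭ d)
cons2-preserves-⊨ {xs = xs} {ys} zs↭ d@(F-ex-sub {Γ} {Δ} dSh dB _) =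
  F-fail (⊨-UniqueDom d) (↭-sym (↭-dom-++ Γ Δ (↭-sym Γ↭ys) (fvᵇ-↭-dom dB)))
  where
  Γ↭ys : dom Γ ↭ ys
  Γ↭ys with share-inv dSh
  ... | shared Γ₀ σ p dF _ = ↭-trans (dom-↭ (proj₂ (↭-∷-cancel (⊨-UniqueDom dSh) refl p)))
          (↭-++-cancelˡ xs (subst (_↭ xs ++ ys) (dom-strictCtx-++ σ xs Γ₀) (↭-trans (fail-inv dF) zs↭)))
  ... | weakened Γ₀ refl p dF _ = ↭-trans (dom-↭ (proj₂ (↭-∷-cancel (⊨-UniqueDom dSh) refl p)))
          (↭-trans (fail-inv dF) zs↭)

cons3-preserves-⊨ : ∀ {Θ zs ys x N τ} → zs ↭ x ∷ ys → Θ ⊨ lsub (fail zs) N x ∶ τ →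
                    Θ ⊨ fail (ys ++ fv N) ∶ τ
cons3-preserves-⊨ zs↭ (F-exch Θ↭Θ' d) = F-exch Θ↭Θ' (cons3-preserves-⊨ zs↭ d)
cons3-preserves-⊨ zs↭ d@(F-ex-lin-sub {Γ} {Δ} dF dN _) =
  F-fail (⊨-UniqueDom d) (↭-sym (↭-dom-++ Γ Δ Γ↭ys (fv-↭-dom dN)))
  where Γ↭ys = ↭-sym (drop-∷ (↭-trans (fail-inv dF) zs↭))

-- Linear head substitution

var-injective : ∀ {x y} → var x ≡ var y → x ≡ y
var-injective refl = refl

headSh≡var⁻ : ∀ {h ys y x} → x ≢ y → headSh h ys y ≡ var x → h ≡ var x × x ∉ ys
headSh≡var⁻ {var w} {ys} x≢y eq with elemᵇ w ys in w∈?ys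
headSh≡var⁻ {var w} {ys} x≢y eq   | true  = ⊥-elim (x≢y (sym (var-injective eq)))
headSh≡var⁻ {var w} {ys} x≢y refl | false = refl , λ w∈ys → subst T w∈?ys (∈⇒elemᵇ w∈ys)
headSh≡var⁻ {lam _ _ _}     _ ()
headSh≡var⁻ {app _ _}       _ ()
headSh≡var⁻ {lsub _ _ _}    _ ()
headSh≡var⁻ {fail _}        _ ()
headSh≡var⁻ {share _ _ _}   _ ()
headSh≡var⁻ {esub _ _ _ _}  _ ()

∈-dom-++⁺ˡ : ∀ {x} Γ Δ → x ∈ dom Γ → x ∈ dom (Γ ++ Δ)
∈-dom-++⁺ˡ Γ Δ x∈Γ = subst (_ ∈_) (sym (dom-++ Γ Δ)) (∈-++⁺ˡ x∈Γ)

head-in-dom : ∀ {M N x M' Θ τ} → M ⟪ N / x ⟫≔ M' → head M ≡ var x → Θ ⊨ M ∶ τ → x ∈ dom Θ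
head-in-dom r h (F-exch Θ↭Θ' d) = ∈-resp-↭ (dom-↭ Θ↭Θ') (head-in-dom r h d)
head-in-dom lhs-var _ F-var = here refl
head-in-dom (lhs-app r) h (F-app {Γ} {Δ} d _ _) = ∈-dom-++⁺ˡ Γ Δ (head-in-dom r h d)
head-in-dom (lhs-lsub x≢y _ r) h (F-ex-lin-sub {Γ} {Δ} d _ _) =
  ∈-dom-++⁺ˡ Γ Δ (∈-∷-≢ x≢y (head-in-dom r h d))
head-in-dom (lhs-share x≢y _ r) h (F-share {Γ} {xs = ys} {σ = σ} d _ _) with headSh≡var⁻ x≢y h
... | h' , x∉ys = there (∈-++-∉ˡ x∉ys (subst (_ ∈_) (dom-strictCtx-++ σ ys Γ) (head-in-dom r h' d)))
head-in-dom (lhs-share x≢y _ r) h (F-weak d _) = there (head-in-dom r (proj₁ (headSh≡var⁻ x≢y h)) d)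
head-in-dom (lhs-esub x≢y ys#N _ r) h (F-ex-sub {Γ} {Δ} d _ _) =
  ∈-dom-++⁺ˡ Γ Δ (∈-∷-≢ x≢y (head-in-dom (lhs-share x≢y ys#N r) h d))

∈⇒↭-∷ : ∀ {v : A} {xs} → v ∈ xs → ∃ λ ys → xs ↭ v ∷ ys
∈⇒↭-∷ {v = v} v∈xs with ∈-∃++ v∈xs
... | ys , zs , refl = ys ++ zs , shift v ys zs

locate-++ˡ : ∀ Γ₁ {Δ₁ Γ x c} → UniqueDom (Γ₁ ++ Δ₁) → Γ₁ ++ Δ₁ ↭ (x , c) ∷ Γ →
             x ∈ dom Γ₁ → ∃ λ G → Γ₁ ↭ (x , c) ∷ G × G ++ Δ₁ ↭ Γ
locate-++ˡ Γ₁ {Δ₁} u p x∈Γ₁ with ∈-++⁻ Γ₁ (∈-resp-↭ (↭-sym p) (here refl))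
... | inj₂ xc∈Δ₁ = ⊥-elim (UniqueDom-++⇒Disjoint Γ₁ u (x∈Γ₁ , ∈-map⁺ proj₁ xc∈Δ₁))
... | inj₁ xc∈Γ₁ with ∈⇒↭-∷ xc∈Γ₁
... | G , Γ₁↭ = G , Γ₁↭ , drop-∷ (↭-trans (↭-sym (++⁺ʳ Δ₁ Γ₁↭)) p)

locate-∷ : ∀ {y x : Var} {c c' : CTy} {Γ₁ Γ} → (y , c) ∷ Γ₁ ↭ (x , c') ∷ Γ → x ≢ y →
           ∃ λ G → Γ₁ ↭ (x , c') ∷ G × (y , c) ∷ G ↭ Γ
locate-∷ p x≢y with ∈-resp-↭ (↭-sym p) (here refl)
... | here eq = ⊥-elim (x≢y (cong proj₁ eq))
... | there xc∈Γ₁ with ∈⇒↭-∷ xc∈Γ₁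
... | G , Γ₁↭ = G , Γ₁↭ , drop-∷ (↭-trans (swap _ _ refl) (↭-trans (↭-sym (prep _ Γ₁↭)) p))

reframe-++ : ∀ G Δ₁ {Γ Δ} → UniqueDom (Γ ++ Δ) → G ++ Δ₁ ↭ Γ →
             (G ++ Δ) ++ Δ₁ ↭ Γ ++ Δ × Disjoint (dom G) (dom Δ) × Disjoint (dom (G ++ Δ)) (dom Δ₁)
reframe-++ G Δ₁ {Γ} {Δ} u GΔ₁↭Γ =
  perm , UniqueDom-++⇒Disjoint G (UniqueDom-++⁻ˡ (G ++ Δ) u') , UniqueDom-++⇒Disjoint (G ++ Δ) u'
  where
  open PermutationReasoning
  perm : (G ++ Δ) ++ Δ₁ ↭ Γ ++ Δ
  perm = begin
    (G ++ Δ) ++ Δ₁  ≡⟨ ++-assoc G Δ Δ₁ ⟩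
    G ++ Δ ++ Δ₁    ↭⟨ ++⁺ˡ G (++-comm Δ Δ₁) ⟩
    G ++ Δ₁ ++ Δ    ≡⟨ ++-assoc G Δ₁ Δ ⟨
    (G ++ Δ₁) ++ Δ  ↭⟨ ++⁺ʳ Δ GΔ₁↭Γ ⟩
    Γ ++ Δ          ∎
  u' = UniqueDom-resp-↭ (↭-sym perm) u

reframe-∷ : ∀ {y : Var} {c : CTy} {G Γ Δ} → UniqueDom (Γ ++ Δ) → (y , c) ∷ G ↭ Γ →
            y ∉ dom (G ++ Δ) × Disjoint (dom G) (dom Δ)
reframe-∷ {G = G} {Δ = Δ} u yG↭Γ = Unique-head u' , UniqueDom-++⇒Disjoint G (Unique-tail u')
  where u' = UniqueDom-resp-↭ (↭-sym (++⁺ʳ Δ yG↭Γ)) u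

↭-under-∷ : ∀ {a b : A} {xs ys} → xs ↭ a ∷ ys → b ∷ xs ↭ a ∷ b ∷ ys
↭-under-∷ xs↭ = ↭-trans (prep _ xs↭) (swap _ _ refl)

∉fv⇒∉dom : ∀ {Δ N σ y} → Δ ⊨ N ∶ σ → y ∉ fv N → y ∉ dom Δ
∉fv⇒∉dom dN y∉N y∈Δ = y∉N (∈-resp-↭ (↭-sym (fv-↭-dom dN)) y∈Δ)

substituted-UniqueDom : ∀ {Θ M τ x σ Γ Δ N} → Θ ⊨ M ∶ τ → Θ ↭ (x , strict σ) ∷ Γ → Δ ⊨ N ∶ σ →
                        Disjoint (dom Γ) (dom Δ) → UniqueDom (Γ ++ Δ)
substituted-UniqueDom d p dN Γ#Δ =
  UniqueDom-++⁺ (Unique-tail (UniqueDom-resp-↭ p (⊨-UniqueDom d))) (⊨-UniqueDom dN) Γ#Δ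

-- The derivation is followed along the head path; the context is tracked only up to permutation
-- because F-exch can occur at any node.
linear-head-subst-⊨ : ∀ {M N x M' Θ Γ Δ σ τ} → M ⟪ N / x ⟫≔ M' → head M ≡ var x →
                      Θ ⊨ M ∶ τ → Θ ↭ (x , strict σ) ∷ Γ → Δ ⊨ N ∶ σ → Disjoint (dom Γ) (dom Δ) →
                      (Γ ++ Δ) ⊨ M' ∶ τ
linear-head-subst-⊨ r h (F-exch Θ'↭Θ d) p = linear-head-subst-⊨ r h d (↭-trans Θ'↭Θ p)
linear-head-subst-⊨ lhs-var _ F-var p dN _ with ↭-singleton-inv (↭-sym p)
... | refl = dN
linear-head-subst-⊨ (lhs-app r) h d₀@(F-app {Γ₁} {Δ₁} d dB _) p dN Γ#Δ
  with locate-++ˡ Γ₁ (⊨-UniqueDom d₀) p (head-in-dom r h d)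
... | G , Γ₁↭ , GΔ₁↭Γ with reframe-++ G Δ₁ (substituted-UniqueDom d₀ p dN Γ#Δ) GΔ₁↭Γ
... | perm , G#Δ , GΔ#Δ₁ = F-exch perm (F-app (linear-head-subst-⊨ r h d Γ₁↭ dN G#Δ) dB GΔ#Δ₁)
linear-head-subst-⊨ (lhs-lsub x≢y y∉N r) h d₀@(F-ex-lin-sub {Γ₁} {Δ₁} d dL _) p dN Γ#Δ
  with locate-++ˡ Γ₁ (⊨-UniqueDom d₀) p (∈-∷-≢ x≢y (head-in-dom r h d))
... | G , Γ₁↭ , GΔ₁↭Γ with reframe-++ G Δ₁ (substituted-UniqueDom d₀ p dN Γ#Δ) GΔ₁↭Γ
... | perm , G#Δ , GΔ#Δ₁ =
  F-exch perm (F-ex-lin-sub (linear-head-subst-⊨ r h d (↭-under-∷ Γ₁↭) dN yG#Δ) dL GΔ#Δ₁)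
  where yG#Δ = Disjoint-++⁺ˡ Disjoint-[ ∉fv⇒∉dom dN y∉N ]ˡ G#Δ
linear-head-subst-⊨ (lhs-esub x≢y ys#N y∉N r) h d₀@(F-ex-sub {Γ₁} {Δ₁} d dB _) p dN Γ#Δ
  with locate-++ˡ Γ₁ (⊨-UniqueDom d₀) p (∈-∷-≢ x≢y (head-in-dom (lhs-share x≢y ys#N r) h d))
... | G , Γ₁↭ , GΔ₁↭Γ with reframe-++ G Δ₁ (substituted-UniqueDom d₀ p dN Γ#Δ) GΔ₁↭Γ
... | perm , G#Δ , GΔ#Δ₁ =
  F-exch perm (F-ex-sub (linear-head-subst-⊨ (lhs-share x≢y ys#N r) h d (↭-under-∷ Γ₁↭) dN yG#Δ) dB GΔ#Δ₁)
  where yG#Δ = Disjoint-++⁺ˡ Disjoint-[ ∉fv⇒∉dom dN y∉N ]ˡ G#Δ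
linear-head-subst-⊨ {Δ = Δ} (lhs-share x≢y ys#N r) h d₀@(F-share {Γ₁} {xs = ys} {σ = ρ} d _ ys≢[]) p dN Γ#Δ
  with locate-∷ p x≢y | headSh≡var⁻ x≢y h
... | G , Γ₁↭ , yG↭Γ | h' , _ with reframe-∷ (substituted-UniqueDom d₀ p dN Γ#Δ) yG↭Γ
... | y∉GΔ , G#Δ =
  F-exch (++⁺ʳ Δ yG↭Γ) (F-share (subst (_⊨ _ ∶ _) (++-assoc (strictCtx ρ ys) G Δ) IH) y∉GΔ ys≢[])
  where
  ysG#Δ : Disjoint (dom (strictCtx ρ ys ++ G)) (dom Δ)
  ysG#Δ = subst (λ zs → Disjoint zs (dom Δ)) (sym (dom-strictCtx-++ ρ ys G))
            (Disjoint-++⁺ˡ (Disjoint-resp-↭ refl (fv-↭-dom dN) ys#N) G#Δ)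
  IH = linear-head-subst-⊨ r h' d (↭-trans (++⁺ˡ (strictCtx ρ ys) Γ₁↭) (shift _ (strictCtx ρ ys) G)) dN ysG#Δ
linear-head-subst-⊨ {Δ = Δ} (lhs-share x≢y _ r) h d₀@(F-weak d _) p dN Γ#Δ
  with locate-∷ p x≢y | headSh≡var⁻ x≢y h
... | G , Γ₁↭ , yG↭Γ | h' , _ with reframe-∷ (substituted-UniqueDom d₀ p dN Γ#Δ) yG↭Γ
... | y∉GΔ , G#Δ = F-exch (++⁺ʳ Δ yG↭Γ) (F-weak (linear-head-subst-⊨ r h' d Γ₁↭ dN G#Δ) y∉GΔ)

linFetch-preserves-⊨ : ∀ {Θ M N x M' τ} → head M ≡ var x → M ⟪ N / x ⟫≔ M' →
                       Θ ⊨ lsub M N x ∶ τ → Θ ⊨ M' ∶ τ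
linFetch-preserves-⊨ h r (F-exch Θ↭Θ' d)        = F-exch Θ↭Θ' (linFetch-preserves-⊨ h r d)
linFetch-preserves-⊨ h r (F-ex-lin-sub d dN Γ#Δ) = linear-head-subst-⊨ r h d refl dN Γ#Δ

theorem3p17 : ∀ {Γ : Ctx} {𝕄 𝕄' : Expr} {τ : Ty} →
              Γ ⊨ₑ 𝕄 ∶ τ → 𝕄 ⟶ 𝕄' → Γ ⊨ₑ 𝕄' ∶ τ
theorem3p17 (F-term d) RS-Beta                   = F-term (beta-preserves-⊨ d)
theorem3p17 (F-term _) (RS-ExSub {xs = []} _ _ () _)
theorem3p17 (F-term d) (RS-ExSub {M} {y ∷ ys} {B = B} _ |B|≡ _ xs#B) =
  Σ⁺-⊨ (λ Bs → linSubs M Bs (y ∷ ys)) (PER B) λ _ Bs∈ →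
    exSub-summand-⊨ d |B|≡ xs#B (perms-↭ (bagList B) Bs∈)
theorem3p17 (F-term d) (RS-LinFetch h r)         = F-term (linFetch-preserves-⊨ h r d)
theorem3p17 (F-term d) (RS-Fail {B = B} _)       = Σ⁺-⊨ _ (PER B) λ _ _ → fail-preserves-⊨ d
theorem3p17 (F-term d) (RS-Cons1 {B = B})        = Σ⁺-⊨ _ (PER B) λ _ _ → cons1-preserves-⊨ d
theorem3p17 (F-term d) (RS-Cons2 {B = B} zs↭ _)  = Σ⁺-⊨ _ (PER B) λ _ _ → cons2-preserves-⊨ zs↭ d
theorem3p17 (F-term d) (RS-Cons3 zs↭)            = F-term (cons3-preserves-⊨ zs↭ d)
theorem3p17 (F-term d) (RS-TCont C M⟶𝕄') with plug-inv C d
... | plugged dM refill = mapE-⊨ (plug C) refill (theorem3p17 (F-term dM) M⟶𝕄')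
theorem3p17 (F-sum d d') (RS-ECont-l 𝕄⟶𝕄')     = F-sum (theorem3p17 d 𝕄⟶𝕄') d'
theorem3p17 (F-sum d d') (RS-ECont-r 𝕄⟶𝕄')     = F-sum d (theorem3p17 d' 𝕄⟶𝕄')
theorem3p17 d (RS-AC 𝕄≈ 𝕄₁⟶𝕄₂ ≈𝕄')            =
  ≈ₛ-preserves-⊨ ≈𝕄' (theorem3p17 (≈ₛ-preserves-⊨ 𝕄≈ d) 𝕄₁⟶𝕄₂)
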